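{- Let $q$ be a positive integer and let $a_0,a_1,\dots,a_q$ be integers with $|a_j| \leq q-1$ for all $j \in [0,q]$. Then $$\alpha\Bigl(2^{3q^2-1}-\sum_{j=0}^{q} a_j2^{jq} + 1\Bigr) \leq (q+1)\lceil \log_2 q \rceil+3.$$
   Context: For a finite family $\mathcal{S}=\{S_1,\dots,S_t\}$ of finite sets, $\mathbf{ID}(\mathcal{S})=2^{S_1}\cup\cdots\cup 2^{S_t}$ (all sets contained in some member of $\mathcal{S}$). For a positive integer $k$, $\alpha(k)$ is the minimum of $|\mathcal{S}|$ over all finite families $\mathcal{S}$ of finite sets with $|\mathbf{ID}(\mathcal{S})|=k$. -}

module Defs where

open import Data.Bool using (Bool; true; false)
open import Data.Nat using (ℕ; zero; suc)
open import Data.Fin using (Fin)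
open import Data.Fin.Subset using (Subset; _⊆_)
open import Data.Fin.Subset.Properties using (_⊆?_)
open import Data.Vec using (_∷_; [])
open import Data.List using (List; []; _∷_; map; _++_; filter; length; foldr)
open import Data.List.Relation.Unary.Any using (Any; any?)
open import Data.Integer using (ℤ; 0ℤ; _+_)

allSubsets : (n : ℕ) → List (Subset n)
allSubsets zero = [] ∷ []
allSubsets (suc n) = map (false ∷_) (allSubsets n) ++ map (true ∷_) (allSubsets n)

InID : {n : ℕ} → List (Subset n) → Subset n → Set
InID S T = Any (T ⊆_) S

idSize : {n : ℕ} → List (Subset n) → ℕ
idSize {n} S = length (filter (λ T → any? (T ⊆?_) S) (allSubsets n))

sumℤ : List ℤ → ℤ
sumℤ = foldr _+_ 0ℤ

-- Splitting the subsets of the ground set by one vertex v gives |ID(S)| = |ID(S ∖ v)| + |ID(lk v)|.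
-- Consequently, adding a member made of s fresh vertices together with a set u that already lies in
-- ID(S) increases |ID(S)| by (2^s − 1)·2^|u|. Starting from one base member of K = 3q² − 2 vertices,
-- a "block" of s fresh vertices and k base vertices thus contributes 2^(s+k) − 2^k.
--
-- Split Σⱼ aⱼ 2^(jq) = P − Q, where P and Q collect the binary digits of the positive and negative
-- parts of the aⱼ: at most ⌈log₂ q⌉ digits per coefficient, each inside its own window of width q,
-- so all positions are distinct and below K. Then
--   2^(K+1) + 1 − P + Q = 2^K + (2^K − 1 − P) + 2 + Q,
-- where 2^K − 1 − P is the sum of the |P| + 1 runs of powers between consecutive digits of P, and 2 and
-- every power 2^p in Q are single blocks: |P| + |Q| + 3 members in total.

module Submission where

open import Defs
import Algebra.Properties.CommutativeSemigroup as CommSemigroupProperties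
open import Data.Bool using (true; false)
open import Data.Fin using (Fin; toℕ) renaming (zero to fzero; suc to fsuc)
open import Data.Fin.Subset using (Subset; _⊆_; ⊤; ⊥; inside; outside) renaming (∣_∣ to ∣_∣ˢ)
open import Data.Fin.Subset.Properties using (_⊆?_; out⊆; drop-∷-⊆; in⊆in; s⊆s; ⊆-trans; ⊆⊤; ∣⊥∣≡0; ∣⊤∣≡n)
open import Data.Integer using (ℤ; +_; -[1+_]; ∣_∣)
open import Data.Integer as Z using ()
import Data.Integer.Properties as Z
import Data.Integer.Tactic.RingSolver as Z
open import Data.List using (List; []; _∷_; map; filter; length; _++_; tabulate; allFin)
open import Data.List.Properties
  using (filter-++; filter-≐; length-++; length-map; map-id; map-∘; map-++; tabulate-cong; map-tabulate)
open import Data.List.Relation.Unary.All as All using (All; []; _∷_)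
import Data.List.Relation.Unary.All.Properties as All
open import Data.List.Relation.Unary.Any as Any using (here; there; any?)
open import Data.List.Relation.Unary.Any.Properties using (map⁺; map⁻)
open import Data.Nat using (ℕ; zero; suc; _≤_; _<_; _∸_; _^_; _*_; _+_; z≤n; s≤s; ⌈_/2⌉)
open import Data.Nat.Induction using (<-wellFounded)
open import Data.Nat.ListAction using (sum)
open import Data.Nat.ListAction.Properties using (sum-++)
open import Data.Nat.Logarithm using (⌈log₂_⌉; ⌈log₂⌉-mono-≤; ⌈log₂2^n⌉≡n)
open import Data.Nat.Logarithm.Core using (⌈log2⌉)
open import Data.Nat.Properties
open import Data.Nat.Tactic.RingSolver using (solve-∀)
open import Data.Product using (Σ; ∃-syntax; _×_; _,_; proj₂; uncurry)
open import Data.Vec using (_∷_; []; tail) renaming (here to here[]=; _++_ to _++ᵛ_)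
open import Function using (_∘_)
open import Induction.WellFounded using (Acc; acc)
open import Relation.Binary.PropositionalEquality
open import Relation.Nullary using (does)
open import Relation.Unary using (Decidable)

module ℕ+ = CommSemigroupProperties +-commutativeSemigroup
module Z+ = CommSemigroupProperties Z.+-commutativeSemigroup

private
  variable
    n : ℕ

-- Counting ID(S) through the deletion and the link of a vertex

length-filter-map : ∀ {A B : Set} {P : B → Set} (P? : Decidable P) (f : A → B) xs →
  length (filter P? (map f xs)) ≡ length (filter (P? ∘ f) xs)
length-filter-map P? f []       = refl
length-filter-map P? f (x ∷ xs) with does (P? (f x))
... | true  = cong suc (length-filter-map P? f xs)
... | false = length-filter-map P? f xs

deletion : List (Subset (suc n)) → List (Subset n)
deletion = map tail

link : List (Subset (suc n)) → List (Subset n)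
link []                  = []
link ((inside  ∷ w) ∷ S) = w ∷ link S
link ((outside ∷ w) ∷ S) = link S

idSize-cong : {S S′ : List (Subset n)} →
  (∀ {T} → InID S T → InID S′ T) → (∀ {T} → InID S′ T → InID S T) → idSize S ≡ idSize S′
idSize-cong {n} {S} {S′} to from =
  cong length (filter-≐ (λ T → any? (T ⊆?_) S) (λ T → any? (T ⊆?_) S′) (to , from) (allSubsets n))

InID-deletion⁺ : (S : List (Subset (suc n))) {T : Subset n} → InID S (outside ∷ T) → InID (deletion S) T
InID-deletion⁺ S p = map⁺ (Any.map (λ { {_ ∷ _} → drop-∷-⊆ }) p)

InID-deletion⁻ : (S : List (Subset (suc n))) {T : Subset n} → InID (deletion S) T → InID S (outside ∷ T)
InID-deletion⁻ S p = Any.map (λ { {_ ∷ _} → out⊆ }) (map⁻ p)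

InID-link⁺ : (S : List (Subset (suc n))) {T : Subset n} → InID S (inside ∷ T) → InID (link S) T
InID-link⁺ ((inside  ∷ w) ∷ S) (here T⊆w) = here (drop-∷-⊆ T⊆w)
InID-link⁺ ((inside  ∷ w) ∷ S) (there p)  = there (InID-link⁺ S p)
InID-link⁺ ((outside ∷ w) ∷ S) (here T⊆w) with () ← T⊆w here[]=
InID-link⁺ ((outside ∷ w) ∷ S) (there p)  = InID-link⁺ S p

InID-link⁻ : (S : List (Subset (suc n))) {T : Subset n} → InID (link S) T → InID S (inside ∷ T)
InID-link⁻ ((inside  ∷ w) ∷ S) (here T⊆w) = here (in⊆in T⊆w)
InID-link⁻ ((inside  ∷ w) ∷ S) (there p)  = there (InID-link⁻ S p)
InID-link⁻ ((outside ∷ w) ∷ S) p          = there (InID-link⁻ S p)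

idSize≡deletion+link : (S : List (Subset (suc n))) → idSize S ≡ idSize (deletion S) + idSize (link S)
idSize≡deletion+link {n} S = begin
  length (filter P? (map (outside ∷_) A ++ map (inside ∷_) A))
    ≡⟨ cong length (filter-++ P? (map (outside ∷_) A) _) ⟩
  length (filter P? (map (outside ∷_) A) ++ filter P? (map (inside ∷_) A))
    ≡⟨ length-++ (filter P? (map (outside ∷_) A)) ⟩
  length (filter P? (map (outside ∷_) A)) + length (filter P? (map (inside ∷_) A))
    ≡⟨ cong₂ _+_ (length-filter-map P? (outside ∷_) A) (length-filter-map P? (inside ∷_) A) ⟩
  length (filter (P? ∘ (outside ∷_)) A) + length (filter (P? ∘ (inside ∷_)) A)
    ≡⟨ cong₂ _+_ (cong length (filter-≐ _ _ (InID-deletion⁺ S , InID-deletion⁻ S) A))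
                 (cong length (filter-≐ _ _ (InID-link⁺ S , InID-link⁻ S) A)) ⟩
  idSize (deletion S) + idSize (link S) ∎
  where
  open ≡-Reasoning
  A = allSubsets n
  P? = λ T → any? (T ⊆?_) S

idSize-[] : idSize {n} [] ≡ 0
idSize-[] {zero}  = refl
idSize-[] {suc n} = trans (idSize≡deletion+link {n} []) (cong₂ _+_ (idSize-[] {n}) (idSize-[] {n}))

idSize-singleton : (v : Subset n) → idSize (v ∷ []) ≡ 2 ^ ∣ v ∣ˢ
idSize-singleton []                    = refl
idSize-singleton (inside ∷ v)          = begin
  idSize ((inside ∷ v) ∷ [])        ≡⟨ idSize≡deletion+link ((inside ∷ v) ∷ []) ⟩
  idSize (v ∷ []) + idSize (v ∷ []) ≡⟨ cong (λ x → x + x) (idSize-singleton v) ⟩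
  2 ^ ∣ v ∣ˢ + 2 ^ ∣ v ∣ˢ           ≡⟨ cong (_+_ (2 ^ ∣ v ∣ˢ)) (sym (+-identityʳ _)) ⟩
  2 ^ suc ∣ v ∣ˢ                    ∎
  where open ≡-Reasoning
idSize-singleton {suc n} (outside ∷ v) = begin
  idSize ((outside ∷ v) ∷ [])     ≡⟨ idSize≡deletion+link ((outside ∷ v) ∷ []) ⟩
  idSize (v ∷ []) + idSize {n} [] ≡⟨ cong₂ _+_ (idSize-singleton v) (idSize-[] {n}) ⟩
  2 ^ ∣ v ∣ˢ + 0                  ≡⟨ +-identityʳ _ ⟩
  2 ^ ∣ v ∣ˢ                      ∎
  where open ≡-Reasoning

idSize-absorb : (S : List (Subset n)) {u : Subset n} → InID S u → idSize (u ∷ S) ≡ idSize S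
idSize-absorb S u∈ = idSize-cong to there
  where
  to : ∀ {T} → InID (_ ∷ S) T → InID S T
  to (here T⊆u) = Any.map (⊆-trans T⊆u) u∈
  to (there p)  = p

∣⊤++ᵛ∣ : ∀ s (u : Subset n) → ∣ ⊤ {s} ++ᵛ u ∣ˢ ≡ s + ∣ u ∣ˢ
∣⊤++ᵛ∣ zero    u = refl
∣⊤++ᵛ∣ (suc s) u = cong suc (∣⊤++ᵛ∣ s u)

∣⊥++ᵛ∣ : ∀ s (u : Subset n) → ∣ ⊥ {s} ++ᵛ u ∣ˢ ≡ ∣ u ∣ˢ
∣⊥++ᵛ∣ zero    u = refl
∣⊥++ᵛ∣ (suc s) u = ∣⊥++ᵛ∣ s u

++ᵛ-monoʳ-⊆ : ∀ {m} (r : Subset m) {p q : Subset n} → p ⊆ q → r ++ᵛ p ⊆ r ++ᵛ q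
++ᵛ-monoʳ-⊆ []      p⊆q = p⊆q
++ᵛ-monoʳ-⊆ (b ∷ r) p⊆q = s⊆s (++ᵛ-monoʳ-⊆ r p⊆q)

extend : ∀ s → Subset n → List (Subset n) → List (Subset (s + n))
extend s u S = (⊤ ++ᵛ u) ∷ map (⊥ ++ᵛ_) S

deletion-extend : ∀ s (u : Subset n) S → deletion (extend (suc s) u S) ≡ extend s u S
deletion-extend s u S = cong ((⊤ ++ᵛ u) ∷_) (sym (map-∘ S))

link-extend : ∀ s (u : Subset n) S → link (extend (suc s) u S) ≡ (⊤ ++ᵛ u) ∷ []
link-extend s u S = cong ((⊤ ++ᵛ u) ∷_) (link-fresh S)
  where
  link-fresh : ∀ S → link (map (⊥ {suc s} ++ᵛ_) S) ≡ []
  link-fresh []      = refl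
  link-fresh (w ∷ S) = link-fresh S

idSize-extend : ∀ s (u : Subset n) S → idSize (extend s u S) + 2 ^ ∣ u ∣ˢ ≡ idSize (u ∷ S) + 2 ^ (s + ∣ u ∣ˢ)
idSize-extend zero        u S = cong (λ S′ → idSize (u ∷ S′) + 2 ^ ∣ u ∣ˢ) (map-id S)
idSize-extend {n} (suc s) u S = begin
  idSize (extend (suc s) u S) + 2 ^ ∣ u ∣ˢ
    ≡⟨ cong (_+ 2 ^ ∣ u ∣ˢ) (idSize≡deletion+link (extend (suc s) u S)) ⟩
  idSize (deletion (extend (suc s) u S)) + idSize (link (extend (suc s) u S)) + 2 ^ ∣ u ∣ˢ
    ≡⟨ cong₂ (λ X Y → idSize {s + n} X + idSize Y + 2 ^ ∣ u ∣ˢ) (deletion-extend s u S) (link-extend s u S) ⟩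
  idSize (extend s u S) + idSize ((⊤ {s} ++ᵛ u) ∷ []) + 2 ^ ∣ u ∣ˢ
    ≡⟨ cong (λ x → idSize (extend s u S) + x + 2 ^ ∣ u ∣ˢ)
            (trans (idSize-singleton (⊤ {s} ++ᵛ u)) (cong (2 ^_) (∣⊤++ᵛ∣ s u))) ⟩
  idSize (extend s u S) + 2 ^ (s + ∣ u ∣ˢ) + 2 ^ ∣ u ∣ˢ
    ≡⟨ ℕ+.xy∙z≈xz∙y (idSize (extend s u S)) _ _ ⟩
  idSize (extend s u S) + 2 ^ ∣ u ∣ˢ + 2 ^ (s + ∣ u ∣ˢ)
    ≡⟨ cong (_+ 2 ^ (s + ∣ u ∣ˢ)) (idSize-extend s u S) ⟩
  idSize (u ∷ S) + 2 ^ (s + ∣ u ∣ˢ) + 2 ^ (s + ∣ u ∣ˢ)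
    ≡⟨ +-assoc (idSize (u ∷ S)) _ _ ⟩
  idSize (u ∷ S) + (2 ^ (s + ∣ u ∣ˢ) + 2 ^ (s + ∣ u ∣ˢ))
    ≡⟨ cong (λ x → idSize (u ∷ S) + (2 ^ (s + ∣ u ∣ˢ) + x)) (sym (+-identityʳ _)) ⟩
  idSize (u ∷ S) + 2 ^ (suc s + ∣ u ∣ˢ) ∎
  where open ≡-Reasoning

-- Families built from blocks

initial : ℕ → (n : ℕ) → Subset n
initial zero    n       = ⊥
initial (suc k) zero    = []
initial (suc k) (suc n) = inside ∷ initial k n

∣initial∣ : ∀ {k n} → k ≤ n → ∣ initial k n ∣ˢ ≡ k
∣initial∣ {n = n} z≤n = ∣⊥∣≡0 n
∣initial∣ (s≤s k≤n)   = cong suc (∣initial∣ k≤n)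

-- A block (s , k) is a member made of s fresh vertices and the first k of the K base vertices;
-- the base ⊤ itself is the last member.
Block : Set
Block = ℕ × ℕ

groundSize : ℕ → List Block → ℕ
groundSize K []             = K
groundSize K ((s , _) ∷ bs) = s + groundSize K bs

embed : ∀ K bs → Subset K → Subset (groundSize K bs)
embed K []             v = v
embed K ((s , _) ∷ bs) v = ⊥ ++ᵛ embed K bs v

family : ∀ K bs → List (Subset (groundSize K bs))
family K []             = ⊤ ∷ []
family K ((s , k) ∷ bs) = extend s (embed K bs (initial k K)) (family K bs)

length-family : ∀ K bs → length (family K bs) ≡ suc (length bs)
length-family K []             = refl
length-family K ((s , k) ∷ bs) = cong suc (trans (length-map _ (family K bs)) (length-family K bs))

∣embed∣ : ∀ K bs (v : Subset K) → ∣ embed K bs v ∣ˢ ≡ ∣ v ∣ˢ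
∣embed∣ K []             v = refl
∣embed∣ K ((s , _) ∷ bs) v = trans (∣⊥++ᵛ∣ s (embed K bs v)) (∣embed∣ K bs v)

InID-embed : ∀ K bs (v : Subset K) → InID (family K bs) (embed K bs v)
InID-embed K []             v = here ⊆⊤
InID-embed K ((s , k) ∷ bs) v = there (map⁺ (Any.map (++ᵛ-monoʳ-⊆ ⊥) (InID-embed K bs v)))

powSum : List ℕ → ℕ
powSum ps = sum (map (2 ^_) ps)

idSize-family : ∀ K bs → All (_≤ K) (map proj₂ bs) →
  idSize (family K bs) + powSum (map proj₂ bs) ≡ 2 ^ K + powSum (map (uncurry _+_) bs)
idSize-family K []             []           =
  cong (_+ 0) (trans (idSize-singleton (⊤ {K})) (cong (2 ^_) (∣⊤∣≡n K)))
idSize-family K ((s , k) ∷ bs) (k≤K ∷ k≤Ks) = begin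
  idSize (extend s u F) + (2 ^ k + powSum (map proj₂ bs))
    ≡⟨ cong (λ x → idSize (extend s u F) + (2 ^ x + powSum (map proj₂ bs))) (sym ∣u∣≡k) ⟩
  idSize (extend s u F) + (2 ^ ∣ u ∣ˢ + powSum (map proj₂ bs))
    ≡⟨ sym (+-assoc (idSize (extend s u F)) _ _) ⟩
  idSize (extend s u F) + 2 ^ ∣ u ∣ˢ + powSum (map proj₂ bs)
    ≡⟨ cong (_+ powSum (map proj₂ bs)) (idSize-extend s u F) ⟩
  idSize (u ∷ F) + 2 ^ (s + ∣ u ∣ˢ) + powSum (map proj₂ bs)
    ≡⟨ cong₂ (λ x y → x + 2 ^ (s + y) + powSum (map proj₂ bs)) (idSize-absorb F (InID-embed K bs _)) ∣u∣≡k ⟩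
  idSize F + 2 ^ (s + k) + powSum (map proj₂ bs)
    ≡⟨ ℕ+.xy∙z≈xz∙y (idSize F) _ _ ⟩
  idSize F + powSum (map proj₂ bs) + 2 ^ (s + k)
    ≡⟨ cong (_+ 2 ^ (s + k)) (idSize-family K bs k≤Ks) ⟩
  2 ^ K + powSum (map (uncurry _+_) bs) + 2 ^ (s + k)
    ≡⟨ ℕ+.xy∙z≈x∙zy (2 ^ K) _ _ ⟩
  2 ^ K + (2 ^ (s + k) + powSum (map (uncurry _+_) bs)) ∎
  where
  open ≡-Reasoning
  F = family K bs
  u = embed K bs (initial k K)
  ∣u∣≡k : ∣ u ∣ˢ ≡ k
  ∣u∣≡k = trans (∣embed∣ K bs (initial k K)) (∣initial∣ k≤K)

-- Realizing 2^(K+1) + 1 − P + Q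

powSum-++ : ∀ xs ys → powSum (xs ++ ys) ≡ powSum xs + powSum ys
powSum-++ xs ys = trans (cong sum (map-++ (2 ^_) xs ys)) (sum-++ (map (2 ^_) xs) _)

powSum-map-suc : ∀ ps → powSum (map suc ps) ≡ 2 * powSum ps
powSum-map-suc []       = refl
powSum-map-suc (p ∷ ps) = trans (cong (_+_ (2 ^ suc p)) (powSum-map-suc ps)) (sym (*-distribˡ-+ 2 (2 ^ p) _))

Ascending : ℕ → ℕ → List ℕ → Set
Ascending lo hi []       = lo ≤ hi
Ascending lo hi (p ∷ ps) = lo ≤ p × Ascending (suc p) hi ps

Ascending⇒≤ : ∀ {lo hi} ps → Ascending lo hi ps → lo ≤ hi
Ascending⇒≤ []       lo≤hi        = lo≤hi
Ascending⇒≤ (p ∷ ps) (lo≤p , asc) = ≤-trans lo≤p (<⇒≤ (Ascending⇒≤ ps asc))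

Ascending⇒All< : ∀ {lo hi} ps → Ascending lo hi ps → All (_< hi) ps
Ascending⇒All< []       _         = []
Ascending⇒All< (p ∷ ps) (_ , asc) = Ascending⇒≤ ps asc ∷ Ascending⇒All< ps asc

Ascending-mono : ∀ {lo lo′ hi hi′} ps → lo′ ≤ lo → hi ≤ hi′ → Ascending lo hi ps → Ascending lo′ hi′ ps
Ascending-mono []       lo′≤lo hi≤hi′ lo≤hi        = ≤-trans lo′≤lo (≤-trans lo≤hi hi≤hi′)
Ascending-mono (p ∷ ps) lo′≤lo hi≤hi′ (lo≤p , asc) = ≤-trans lo′≤lo lo≤p , Ascending-mono ps ≤-refl hi≤hi′ asc

Ascending-++ : ∀ {lo mid hi} xs {ys} → Ascending lo mid xs → Ascending mid hi ys → Ascending lo hi (xs ++ ys)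
Ascending-++ []       {ys} lo≤mid       asc  = Ascending-mono ys lo≤mid ≤-refl asc
Ascending-++ (x ∷ xs)      (lo≤x , asc) asc′ = lo≤x , Ascending-++ xs asc asc′

-- the runs [lo, p₀), [p₀ + 1, p₁), …, [pᵣ + 1, K) between consecutive elements of ps
gaps : ℕ → List ℕ → ℕ → List Block
gaps lo []       K = (K ∸ lo , lo) ∷ []
gaps lo (p ∷ ps) K = (p ∸ lo , lo) ∷ gaps (suc p) ps K

length-gaps : ∀ lo ps K → length (gaps lo ps K) ≡ suc (length ps)
length-gaps lo []       K = refl
length-gaps lo (p ∷ ps) K = cong suc (length-gaps (suc p) ps K)

map-proj₂-gaps : ∀ lo ps K → map proj₂ (gaps lo ps K) ≡ lo ∷ map suc ps
map-proj₂-gaps lo []       K = refl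
map-proj₂-gaps lo (p ∷ ps) K = cong (lo ∷_) (map-proj₂-gaps (suc p) ps K)

map-+-gaps : ∀ {lo K} ps → Ascending lo K ps → map (uncurry _+_) (gaps lo ps K) ≡ ps ++ K ∷ []
map-+-gaps []       lo≤K         = cong (_∷ []) (m∸n+n≡m lo≤K)
map-+-gaps (p ∷ ps) (lo≤p , asc) = cong₂ _∷_ (m∸n+n≡m lo≤p) (map-+-gaps ps asc)

pow2Block : ℕ → Block
pow2Block p = (1 , p)

realizingBlocks : ℕ → List ℕ → List ℕ → List Block
realizingBlocks K P Q = gaps 0 P K ++ map pow2Block (1 ∷ Q)

map-proj₂-realizingBlocks : ∀ K P Q → map proj₂ (realizingBlocks K P Q) ≡ (0 ∷ map suc P) ++ 1 ∷ Q
map-proj₂-realizingBlocks K P Q = trans (map-++ proj₂ (gaps 0 P K) _)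
  (cong₂ _++_ (map-proj₂-gaps 0 P K) (trans (sym (map-∘ (1 ∷ Q))) (map-id (1 ∷ Q))))

powSum-lows : ∀ K P Q → powSum (map proj₂ (realizingBlocks K P Q)) ≡ 1 + 2 * powSum P + (2 + powSum Q)
powSum-lows K P Q = begin
  powSum (map proj₂ (realizingBlocks K P Q)) ≡⟨ cong powSum (map-proj₂-realizingBlocks K P Q) ⟩
  powSum ((0 ∷ map suc P) ++ 1 ∷ Q)           ≡⟨ powSum-++ (0 ∷ map suc P) (1 ∷ Q) ⟩
  1 + powSum (map suc P) + (2 + powSum Q)     ≡⟨ cong (λ x → 1 + x + (2 + powSum Q)) (powSum-map-suc P) ⟩
  1 + 2 * powSum P + (2 + powSum Q)           ∎
  where open ≡-Reasoning

powSum-highs : ∀ {K} P Q → Ascending 0 K P →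
  powSum (map (uncurry _+_) (realizingBlocks K P Q)) ≡ powSum P + (2 ^ K + 0) + (4 + 2 * powSum Q)
powSum-highs {K} P Q ascP = begin
  powSum (map (uncurry _+_) (gaps 0 P K ++ map pow2Block (1 ∷ Q)))
    ≡⟨ cong powSum (map-++ (uncurry _+_) (gaps 0 P K) _) ⟩
  powSum (map (uncurry _+_) (gaps 0 P K) ++ map (uncurry _+_) (map pow2Block (1 ∷ Q)))
    ≡⟨ cong₂ (λ xs ys → powSum (xs ++ ys)) (map-+-gaps P ascP) (sym (map-∘ (1 ∷ Q))) ⟩
  powSum ((P ++ K ∷ []) ++ 2 ∷ map suc Q)
    ≡⟨ powSum-++ (P ++ K ∷ []) (2 ∷ map suc Q) ⟩
  powSum (P ++ K ∷ []) + (4 + powSum (map suc Q))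
    ≡⟨ cong₂ (λ x y → x + (4 + y)) (powSum-++ P (K ∷ [])) (powSum-map-suc Q) ⟩
  powSum P + (2 ^ K + 0) + (4 + 2 * powSum Q) ∎
  where open ≡-Reasoning

length-realizingBlocks : ∀ K P Q → length (realizingBlocks K P Q) ≡ 2 + (length P + length Q)
length-realizingBlocks K P Q = begin
  length (gaps 0 P K ++ map pow2Block (1 ∷ Q))               ≡⟨ length-++ (gaps 0 P K) ⟩
  length (gaps 0 P K) + length (map pow2Block (1 ∷ Q))      ≡⟨ cong₂ _+_ (length-gaps 0 P K) (length-map pow2Block (1 ∷ Q)) ⟩
  suc (length P) + suc (length Q)                            ≡⟨ cong suc (+-suc (length P) (length Q)) ⟩
  2 + (length P + length Q)                                  ∎
  where open ≡-Reasoning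

difference-arith : ∀ N E P Q → N + (1 + 2 * P + (2 + Q)) ≡ E + (P + (E + 0) + (4 + 2 * Q)) →
  N + P ≡ 2 * E + 1 + Q
difference-arith N E P Q eq = +-cancelʳ-≡ (P + Q + 3) _ _ (begin
  N + P + (P + Q + 3)             ≡⟨ lhs N P Q ⟩
  N + (1 + 2 * P + (2 + Q))       ≡⟨ eq ⟩
  E + (P + (E + 0) + (4 + 2 * Q)) ≡⟨ rhs E P Q ⟩
  2 * E + 1 + Q + (P + Q + 3)     ∎)
  where
  open ≡-Reasoning
  lhs : ∀ N P Q → N + P + (P + Q + 3) ≡ N + (1 + 2 * P + (2 + Q))
  lhs = solve-∀
  rhs : ∀ E P Q → E + (P + (E + 0) + (4 + 2 * Q)) ≡ 2 * E + 1 + Q + (P + Q + 3)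
  rhs = solve-∀

difference-realizable : ∀ K (P Q : List ℕ) → 1 ≤ K → Ascending 0 K P → Ascending 0 K Q →
  ∃[ n ] Σ (List (Subset n)) λ S →
    length S ≡ 3 + (length P + length Q) × idSize S + powSum P ≡ 2 ^ suc K + 1 + powSum Q
difference-realizable K P Q 1≤K ascP ascQ =
  groundSize K bs , family K bs ,
  trans (length-family K bs) (cong suc (length-realizingBlocks K P Q)) ,
  difference-arith (idSize (family K bs)) (2 ^ K) (powSum P) (powSum Q)
    (subst₂ (λ x y → idSize (family K bs) + x ≡ 2 ^ K + y) (powSum-lows K P Q) (powSum-highs P Q ascP)
      (idSize-family K bs bounded))
  where
  bs = realizingBlocks K P Q
  bounded : All (_≤ K) (map proj₂ bs)
  bounded = subst (All (_≤ K)) (sym (map-proj₂-realizingBlocks K P Q))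
    (z≤n ∷ All.++⁺ (All.map⁺ (Ascending⇒All< P ascP)) (1≤K ∷ All.map <⇒≤ (Ascending⇒All< Q ascQ)))

-- Binary digits in windows

data Halving (v : ℕ) : Set where
  even : ∀ h → v ≡ 2 * h     → Halving v
  odd  : ∀ h → v ≡ 1 + 2 * h → Halving v

halving : ∀ v → Halving v
halving zero          = even 0 refl
halving (suc zero)    = odd 0 refl
halving (suc (suc v)) with halving v
... | even h v≡2h   = even (suc h) (trans (cong (_+_ 2) v≡2h) (sym (*-suc 2 h)))
... | odd  h v≡1+2h = odd (suc h) (trans (cong (_+_ 2) v≡1+2h) (cong suc (sym (*-suc 2 h))))

bitPositions : (c L v : ℕ) → List ℕ
bitPositions c zero    v = []
bitPositions c (suc L) v with halving v
... | even h _ = bitPositions (suc c) L h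
... | odd  h _ = c ∷ bitPositions (suc c) L h

bitPositions-zero : ∀ c L → bitPositions c L 0 ≡ []
bitPositions-zero c zero    = refl
bitPositions-zero c (suc L) = bitPositions-zero (suc c) L

length-bitPositions : ∀ c L v → length (bitPositions c L v) ≤ L
length-bitPositions c zero    v = z≤n
length-bitPositions c (suc L) v with halving v
... | even h _ = m≤n⇒m≤1+n (length-bitPositions (suc c) L h)
... | odd  h _ = s≤s (length-bitPositions (suc c) L h)

Ascending-bitPositions : ∀ c L v → Ascending c (c + L) (bitPositions c L v)
Ascending-bitPositions c zero    v = m≤m+n c 0
Ascending-bitPositions c (suc L) v with halving v
... | even h _ = Ascending-mono (bitPositions (suc c) L h) (n≤1+n c) (≤-reflexive (sym (+-suc c L)))
                   (Ascending-bitPositions (suc c) L h)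
... | odd  h _ = ≤-refl , Ascending-mono (bitPositions (suc c) L h) ≤-refl (≤-reflexive (sym (+-suc c L)))
                            (Ascending-bitPositions (suc c) L h)

m*2^[1+n]≡2*m*2^n : ∀ m n → m * 2 ^ suc n ≡ 2 * m * 2 ^ n
m*2^[1+n]≡2*m*2^n m n = trans (sym (*-assoc m 2 (2 ^ n))) (cong (_* 2 ^ n) (*-comm m 2))

powSum-bitPositions : ∀ c L v → v < 2 ^ L → powSum (bitPositions c L v) ≡ v * 2 ^ c
powSum-bitPositions c zero    zero    _         = refl
powSum-bitPositions c zero    (suc v) (s≤s ())
powSum-bitPositions c (suc L) v v<2^1+L with halving v
... | even h refl =
  trans (powSum-bitPositions (suc c) L h (*-cancelˡ-< 2 h (2 ^ L) v<2^1+L)) (m*2^[1+n]≡2*m*2^n h c)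
... | odd  h refl = cong (_+_ (2 ^ c)) (trans
  (powSum-bitPositions (suc c) L h (*-cancelˡ-< 2 h (2 ^ L) (<-trans (n<1+n (2 * h)) v<2^1+L)))
  (m*2^[1+n]≡2*m*2^n h c))

positivePart negativePart : ℤ → ℕ
positivePart (+ v)    = v
positivePart -[1+ w ] = 0
negativePart (+ v)    = 0
negativePart -[1+ w ] = suc w

+-negativePart : ∀ z → z Z.+ + negativePart z ≡ + positivePart z
+-negativePart (+ v)    = Z.+-identityʳ (+ v)
+-negativePart -[1+ w ] = Z.+-inverseˡ (+ suc w)

positivePart≤∣∣ : ∀ z → positivePart z ≤ ∣ z ∣
positivePart≤∣∣ (+ v)    = ≤-refl
positivePart≤∣∣ -[1+ w ] = z≤n

negativePart≤∣∣ : ∀ z → negativePart z ≤ ∣ z ∣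
negativePart≤∣∣ (+ v)    = z≤n
negativePart≤∣∣ -[1+ w ] = ≤-refl

windowBits : (ℤ → ℕ) → (L q c : ℕ) → (Fin n → ℤ) → List ℕ
windowBits {zero}  f L q c g = []
windowBits {suc n} f L q c g = bitPositions c L (f (g fzero)) ++ windowBits f L q (c + q) (g ∘ fsuc)

windowSum : (q c : ℕ) → (Fin n → ℤ) → ℤ
windowSum q c g = sumℤ (tabulate (λ j → g j Z.* + 2 ^ (c + toℕ j * q)))

windowSum-suc : ∀ q c (g : Fin (suc n) → ℤ) →
  windowSum q c g ≡ g fzero Z.* + 2 ^ c Z.+ windowSum q (c + q) (g ∘ fsuc)
windowSum-suc q c g = cong₂ (λ x y → g fzero Z.* + 2 ^ x Z.+ sumℤ y) (+-identityʳ c)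
  (tabulate-cong (λ j → cong (λ x → g (fsuc j) Z.* + 2 ^ x) (sym (+-assoc c q (toℕ j * q)))))

+powSum-++ : ∀ xs ys → + powSum (xs ++ ys) ≡ + powSum xs Z.+ + powSum ys
+powSum-++ xs ys = trans (cong +_ (powSum-++ xs ys)) (Z.pos-+ (powSum xs) (powSum ys))

+powSum-bitPositions : ∀ c L v → v < 2 ^ L → + powSum (bitPositions c L v) ≡ + v Z.* + 2 ^ c
+powSum-bitPositions c L v v<2^L = trans (cong +_ (powSum-bitPositions c L v v<2^L)) (Z.pos-* v (2 ^ c))

z*2^c+negativeBits≡positiveBits : ∀ c L z → ∣ z ∣ < 2 ^ L →
  z Z.* + 2 ^ c Z.+ + powSum (bitPositions c L (negativePart z)) ≡ + powSum (bitPositions c L (positivePart z))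
z*2^c+negativeBits≡positiveBits c L z ∣z∣<2^L = begin
  z Z.* + 2 ^ c Z.+ + powSum (bitPositions c L (negativePart z))
    ≡⟨ cong (Z._+_ (z Z.* + 2 ^ c)) (+powSum-bitPositions c L _ (≤-<-trans (negativePart≤∣∣ z) ∣z∣<2^L)) ⟩
  z Z.* + 2 ^ c Z.+ + negativePart z Z.* + 2 ^ c
    ≡⟨ sym (Z.*-distribʳ-+ (+ 2 ^ c) z _) ⟩
  (z Z.+ + negativePart z) Z.* + 2 ^ c
    ≡⟨ cong (Z._* + 2 ^ c) (+-negativePart z) ⟩
  + positivePart z Z.* + 2 ^ c
    ≡⟨ sym (+powSum-bitPositions c L _ (≤-<-trans (positivePart≤∣∣ z) ∣z∣<2^L)) ⟩
  + powSum (bitPositions c L (positivePart z)) ∎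
  where open ≡-Reasoning

windowSum+negativeBits≡positiveBits : ∀ L q c (g : Fin n → ℤ) → (∀ j → ∣ g j ∣ < 2 ^ L) →
  windowSum q c g Z.+ + powSum (windowBits negativePart L q c g) ≡ + powSum (windowBits positivePart L q c g)
windowSum+negativeBits≡positiveBits {zero}  L q c g bound = refl
windowSum+negativeBits≡positiveBits {suc n} L q c g bound = begin
  windowSum q c g Z.+ + powSum (N₀ ++ N)
    ≡⟨ cong₂ Z._+_ (windowSum-suc q c g) (+powSum-++ N₀ N) ⟩
  (g fzero Z.* + 2 ^ c Z.+ W) Z.+ (+ powSum N₀ Z.+ + powSum N)
    ≡⟨ Z+.interchange (g fzero Z.* + 2 ^ c) W (+ powSum N₀) (+ powSum N) ⟩
  (g fzero Z.* + 2 ^ c Z.+ + powSum N₀) Z.+ (W Z.+ + powSum N)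
    ≡⟨ cong₂ Z._+_ (z*2^c+negativeBits≡positiveBits c L (g fzero) (bound fzero))
                   (windowSum+negativeBits≡positiveBits L q (c + q) (g ∘ fsuc) (bound ∘ fsuc)) ⟩
  + powSum P₀ Z.+ + powSum P
    ≡⟨ sym (+powSum-++ P₀ P) ⟩
  + powSum (P₀ ++ P) ∎
  where
  open ≡-Reasoning
  W  = windowSum q (c + q) (g ∘ fsuc)
  N₀ = bitPositions c L (negativePart (g fzero))
  P₀ = bitPositions c L (positivePart (g fzero))
  N  = windowBits negativePart L q (c + q) (g ∘ fsuc)
  P  = windowBits positivePart L q (c + q) (g ∘ fsuc)

length-positiveBits+negativeBits : ∀ c L z →
  length (bitPositions c L (positivePart z)) + length (bitPositions c L (negativePart z)) ≤ L
length-positiveBits+negativeBits c L (+ v)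
  rewrite bitPositions-zero c L | +-identityʳ (length (bitPositions c L v)) = length-bitPositions c L v
length-positiveBits+negativeBits c L -[1+ w ]
  rewrite bitPositions-zero c L = length-bitPositions c L (suc w)

length-windowBits : ∀ L q c (g : Fin n → ℤ) →
  length (windowBits positivePart L q c g) + length (windowBits negativePart L q c g) ≤ n * L
length-windowBits {zero}  L q c g = z≤n
length-windowBits {suc n} L q c g = begin
  length (P₀ ++ P) + length (N₀ ++ N)             ≡⟨ cong₂ _+_ (length-++ P₀) (length-++ N₀) ⟩
  (length P₀ + length P) + (length N₀ + length N) ≡⟨ ℕ+.interchange (length P₀) _ _ _ ⟩
  (length P₀ + length N₀) + (length P + length N) ≤⟨ +-mono-≤ (length-positiveBits+negativeBits c L (g fzero))
                                                              (length-windowBits L q (c + q) (g ∘ fsuc)) ⟩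
  L + n * L                                       ∎
  where
  open ≤-Reasoning
  N₀ = bitPositions c L (negativePart (g fzero))
  P₀ = bitPositions c L (positivePart (g fzero))
  N  = windowBits negativePart L q (c + q) (g ∘ fsuc)
  P  = windowBits positivePart L q (c + q) (g ∘ fsuc)

Ascending-windowBits : ∀ f {L q} → L ≤ q → ∀ c (g : Fin (suc n) → ℤ) →
  Ascending c (c + n * q + L) (windowBits f L q c g)
Ascending-windowBits {zero}  f {L}     L≤q c g =
  Ascending-++ (bitPositions c L _) (Ascending-bitPositions c L _) (≤-reflexive (cong (_+ L) (sym (+-identityʳ c))))
Ascending-windowBits {suc n} f {L} {q} L≤q c g =
  Ascending-++ (bitPositions c L _) (Ascending-bitPositions c L _)
    (Ascending-mono (windowBits f L q (c + q) (g ∘ fsuc)) (+-monoʳ-≤ c L≤q)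
      (≤-reflexive (cong (_+ L) (+-assoc c q (n * q)))) (Ascending-windowBits f L≤q (c + q) (g ∘ fsuc)))

+N≡M-X+1 : ∀ N M p q (X : ℤ) → N + p ≡ M + 1 + q → X Z.+ + q ≡ + p → + N ≡ (+ M Z.- X) Z.+ + 1
+N≡M-X+1 N M p q X N+p≡M+1+q X+q≡p = begin
  + N                                   ≡⟨ add-sub (+ N) (+ p) ⟩
  (+ N Z.+ + p) Z.- + p                 ≡⟨ cong (Z._- + p) (sym (Z.pos-+ N p)) ⟩
  + (N + p) Z.- + p                     ≡⟨ cong₂ Z._-_ (cong +_ N+p≡M+1+q) (sym X+q≡p) ⟩
  + (M + 1 + q) Z.- (X Z.+ + q)         ≡⟨ cong (Z._- (X Z.+ + q)) (trans (Z.pos-+ (M + 1) q) (cong (Z._+ + q) (Z.pos-+ M 1))) ⟩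
  (+ M Z.+ + 1 Z.+ + q) Z.- (X Z.+ + q) ≡⟨ cancel (+ M) X (+ q) ⟩
  (+ M Z.- X) Z.+ + 1                   ∎
  where
  open ≡-Reasoning
  add-sub : ∀ a b → a ≡ (a Z.+ b) Z.- b
  add-sub = Z.solve-∀
  cancel : ∀ m x y → (m Z.+ + 1 Z.+ y) Z.- (x Z.+ y) ≡ (m Z.- x) Z.+ + 1
  cancel = Z.solve-∀

windowSum-realizable : ∀ {n} K L q (g : Fin (suc n) → ℤ) → (∀ j → ∣ g j ∣ < 2 ^ L) → L ≤ q → 1 ≤ K →
  n * q + L ≤ K →
  ∃[ N ] Σ (List (Subset N)) λ S →
    length S ≤ suc n * L + 3 × + idSize S ≡ (+ 2 ^ suc K Z.- windowSum q 0 g) Z.+ + 1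
windowSum-realizable {n} K L q g bound L≤q 1≤K range =
  let (N , S , size , count) = difference-realizable K P Q 1≤K (inRange positivePart) (inRange negativePart)
  in N , S , size≤ size ,
     +N≡M-X+1 (idSize S) (2 ^ suc K) (powSum P) (powSum Q) (windowSum q 0 g) count
       (windowSum+negativeBits≡positiveBits L q 0 g bound)
  where
  P = windowBits positivePart L q 0 g
  Q = windowBits negativePart L q 0 g
  inRange : ∀ f → Ascending 0 K (windowBits f L q 0 g)
  inRange f = Ascending-mono (windowBits f L q 0 g) ≤-refl range (Ascending-windowBits f L≤q 0 g)
  size≤ : ∀ {m} → m ≡ 3 + (length P + length Q) → m ≤ suc n * L + 3
  size≤ refl = begin
    3 + (length P + length Q) ≤⟨ +-monoʳ-≤ 3 (length-windowBits L q 0 g) ⟩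
    3 + suc n * L             ≡⟨ +-comm 3 _ ⟩
    suc n * L + 3             ∎
    where open ≤-Reasoning

≤2^⌈log2⌉ : ∀ n (acc : Acc _<_ n) → n ≤ 2 ^ ⌈log2⌉ n acc
≤2^⌈log2⌉ zero          _        = z≤n
≤2^⌈log2⌉ (suc zero)    _        = s≤s z≤n
≤2^⌈log2⌉ (suc (suc n)) (acc rs) = begin
  2 + n                          ≤⟨ +-monoʳ-≤ 2 n≤⌈n/2⌉+⌈n/2⌉ ⟩
  2 + (⌈ n /2⌉ + ⌈ n /2⌉)        ≡⟨ cong (λ x → 2 + (⌈ n /2⌉ + x)) (sym (+-identityʳ _)) ⟩
  2 + 2 * ⌈ n /2⌉                ≡⟨ sym (*-suc 2 ⌈ n /2⌉) ⟩
  2 * suc ⌈ n /2⌉                ≤⟨ *-monoʳ-≤ 2 (≤2^⌈log2⌉ (suc ⌈ n /2⌉) _) ⟩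
  2 * 2 ^ ⌈log2⌉ (suc ⌈ n /2⌉) _ ∎
  where
  open ≤-Reasoning
  n≤⌈n/2⌉+⌈n/2⌉ : n ≤ ⌈ n /2⌉ + ⌈ n /2⌉
  n≤⌈n/2⌉+⌈n/2⌉ = subst (_≤ ⌈ n /2⌉ + ⌈ n /2⌉) (⌊n/2⌋+⌈n/2⌉≡n n) (+-monoˡ-≤ ⌈ n /2⌉ (⌊n/2⌋≤⌈n/2⌉ n))

≤2^⌈log₂⌉ : ∀ n → n ≤ 2 ^ ⌈log₂ n ⌉
≤2^⌈log₂⌉ n = ≤2^⌈log2⌉ n (<-wellFounded n)

1+n≤2^n : ∀ n → 1 + n ≤ 2 ^ n
1+n≤2^n zero    = ≤-refl
1+n≤2^n (suc n) = +-mono-≤ (m^n>0 2 n) (≤-trans (1+n≤2^n n) (m≤m+n (2 ^ n) 0))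

⌈log₂1+n⌉≤n : ∀ n → ⌈log₂ (1 + n) ⌉ ≤ n
⌈log₂1+n⌉≤n n = subst (⌈log₂ (1 + n) ⌉ ≤_) (⌈log₂2^n⌉≡n n) (⌈log₂⌉-mono-≤ (1+n≤2^n n))

lemma40 : (q : ℕ) → 1 ≤ q → (a : Fin (suc q) → ℤ) → (∀ j → ∣ a j ∣ ≤ q ∸ 1) →
    ∃[ n ] Σ (List (Subset n)) (λ S →
      (length S ≤ suc q * ⌈log₂ q ⌉ + 3) ×
      (+ idSize S ≡
        (+ (2 ^ (3 * (q * q) ∸ 1)) Z.-
          sumℤ (map (λ j → a j Z.* + (2 ^ (toℕ j * q))) (allFin (suc q))))
        Z.+ + 1))
lemma40 (suc r) _ a ∣a∣≤r =
  let (N , S , size , count) = windowSum-realizable K L (suc r) a ∣a∣<2^L (m≤n⇒m≤1+n L≤r) (s≤s z≤n) range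
  in N , S , size , trans count (cong₂ (λ e X → (+ 2 ^ e Z.- X) Z.+ + 1) (sym 3q²∸1≡1+K) (sym sum≡windowSum))
  where
  L = ⌈log₂ suc r ⌉
  L≤r : L ≤ r
  L≤r = ⌈log₂1+n⌉≤n r
  ∣a∣<2^L : ∀ j → ∣ a j ∣ < 2 ^ L
  ∣a∣<2^L j = ≤-trans (s≤s (∣a∣≤r j)) (≤2^⌈log₂⌉ (suc r))
  -- K = 3q² − 2 for q = r + 1, without truncated subtraction
  K = suc (3 * (r * r) + 6 * r)
  3q²≡2+K : ∀ r → 3 * (suc r * suc r) ≡ 2 + suc (3 * (r * r) + 6 * r)
  3q²≡2+K = solve-∀
  3q²∸1≡1+K : 3 * (suc r * suc r) ∸ 1 ≡ suc K
  3q²∸1≡1+K = cong (_∸ 1) (3q²≡2+K r)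
  K≡q²+r+_ : ∀ r → suc (3 * (r * r) + 6 * r) ≡ suc r * suc r + r + (2 * (r * r) + 3 * r)
  K≡q²+r+_ = solve-∀
  range : suc r * suc r + L ≤ K
  range = ≤-trans (+-monoʳ-≤ (suc r * suc r) L≤r) (≤-trans (m≤m+n _ _) (≤-reflexive (sym (K≡q²+r+_ r))))
  sum≡windowSum : sumℤ (map (λ j → a j Z.* + 2 ^ (toℕ j * suc r)) (allFin (suc (suc r)))) ≡ windowSum (suc r) 0 a
  sum≡windowSum = cong sumℤ (map-tabulate (λ j → j) (λ j → a j Z.* + 2 ^ (toℕ j * suc r)))
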